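{- Let $G$ be a finite simple graph with clique number $\omega(G) \geq 2$. Then \[ \mathrm{MOF}(G) \geq \omega(G) - \frac{2\omega(G)}{\log_2(\omega(G))}. \]
   Context: $\omega(G)$ is the maximum order of a complete subgraph of $G$. An orientation of $G$ assigns to each edge $\{u,v\}$ exactly one of the arcs $(u,v)$ or $(v,u)$; if $(u,v)$ is an arc, $v$ is an out-neighbor of $u$. Oriented forcing: given an orientation $D$ and a set $S$ of initially colored vertices, any colored vertex having at most $1$ non-colored out-neighbor forces that out-neighbor to become colored; this rule is applied iteratively as long as possible. $S$ is a forcing set of $D$ if at the end every vertex is colored. $F(D)$ is the minimum size of a forcing set of $D$, and $\mathrm{MOF}(G)$ is the maximum of $F(D)$ over all orientations $D$ of $G$. -}

module Defs where

open import Data.Nat using (ℕ; _≤_)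
open import Data.Bool using (Bool; true; false)
open import Data.Fin using (Fin)
open import Data.Fin.Subset using (Subset; _∈_; ∣_∣)
open import Data.Product using (Σ; _×_)
open import Data.Sum using (_⊎_)
open import Relation.Binary.PropositionalEquality using (_≡_; _≢_)

record Graph (n : ℕ) : Set where
  field
    Adj   : Fin n → Fin n → Bool
    sym   : ∀ u v → Adj u v ≡ Adj v u
    irref : ∀ v → Adj v v ≡ false
open Graph public

IsClique : ∀ {n} → Graph n → Subset n → Set
IsClique G S = ∀ u v → u ∈ S → v ∈ S → u ≢ v → Adj G u v ≡ true

IsCliqueNumber : ∀ {n} → Graph n → ℕ → Set
IsCliqueNumber {n} G w =
  (Σ (Subset n) λ S → IsClique G S × ∣ S ∣ ≡ w) ×
  (∀ (S : Subset n) → IsClique G S → ∣ S ∣ ≤ w)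

record Orientation {n : ℕ} (G : Graph n) : Set where
  field
    Arc      : Fin n → Fin n → Bool
    arc-edge : ∀ u v → Arc u v ≡ true → Adj G u v ≡ true
    edge-arc : ∀ u v → Adj G u v ≡ true →
               ((Arc u v ≡ true) × (Arc v u ≡ false)) ⊎
               ((Arc u v ≡ false) × (Arc v u ≡ true))
open Orientation public

-- Oriented forcing closure from initial colored set S: the least set
-- containing S and closed under the rule "a colored vertex u all of whose
-- out-neighbours other than v are colored forces its out-neighbour v".
-- (The rule is monotone, so this equals the result of iterating it.)
data Colored {n : ℕ} {G : Graph n} (D : Orientation G) (S : Subset n)
     : Fin n → Set where
  initial : ∀ {v} → v ∈ S → Colored D S v
  force   : ∀ {u v} → Colored D S u → Arc D u v ≡ true →
            (∀ w → Arc D u w ≡ true → w ≢ v → Colored D S w) →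
            Colored D S v

IsForcingSet : ∀ {n} {G : Graph n} → Orientation G → Subset n → Set
IsForcingSet {n} D S = ∀ (v : Fin n) → Colored D S v

IsForcingNumber : ∀ {n} {G : Graph n} → Orientation G → ℕ → Set
IsForcingNumber {n} D f =
  (Σ (Subset n) λ S → IsForcingSet D S × ∣ S ∣ ≡ f) ×
  (∀ (S : Subset n) → IsForcingSet D S → f ≤ ∣ S ∣)

IsMOF : ∀ {n} → Graph n → ℕ → Set
IsMOF G m =
  (Σ (Orientation G) λ D → IsForcingNumber D m) ×
  (∀ (D : Orientation G) (f : ℕ) → IsForcingNumber D f → f ≤ m)

-- Let K be a clique of size w and r = w ∸ MOF(G). Extend a tournament T on K to an
-- orientation of G in which every edge between K and the rest of G leaves K. A forcing
-- set has at most MOF(G) vertices, so at least r vertices of K start uncoloured; the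
-- vertex forcing the first of them lies in K, and all the other uncoloured vertices of
-- K beat it. Repeating this a times shows that whenever a + b ≤ r some b-subset of K
-- beats some a-subset of K in T. Hence r < a + b as soon as K carries a tournament in
-- which no b-set beats an a-set. For w < 32 the Paley tournaments on 11, 19 and 31
-- vertices give such tournaments with a = 2; for larger w, counting tournaments shows
-- that one exists whenever C(w,a) C(w,b) < 2^(ab), and a, b ≈ 2 log₂ w then give
-- w ^ (a + b − 1) ≤ 4 ^ w.
module Submission where

open import Defs renaming (sym to Adj-sym)

open import Data.Bool using (Bool; true; false; not; _∧_; T; if_then_else_)
open import Data.Bool.Properties
  using (not-involutive; ∧-conicalˡ; ∧-conicalʳ; ∧-zeroʳ; T-≡) renaming (_≟_ to _≟ᵇ_)
open import Data.Empty using (⊥-elim)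
open import Data.Fin using (Fin; zero; suc; toℕ)
open import Data.Fin.Properties using (all?; any?; toℕ-fromℕ<) renaming (_≟_ to _≟ᶠ_)
import Data.Fin.Properties as Finₚ
open import Data.Fin.Subset
  using (Subset; Side; inside; outside; _∈_; _∉_; _⊆_; _∪_; _∩_; _─_; _-_; ∁; ⁅_⁆; ∣_∣; Nonempty; Lift)
  renaming (⊥ to ∅; ⊤ to full)
open import Data.Fin.Subset.Properties
  using (_∈?_; _⊆?_; ⊆-refl; ⊆-min; ∣⊥∣≡0; out⊆; s⊆s; p─⊥≡p; p─q⊆p; x∈p∧x≢y⇒x∈p-y; x∉⁅y⁆⇒x≢y;
         x∈⁅y⁆⇒x≡y; x∈p∩q⁺; x∈p∪q⁻; ∪-identityˡ; ∈⊤; ∣⊤∣≡n; ∉⊥)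
open import Data.Nat
  using (ℕ; zero; suc; _+_; _*_; _∸_; _^_; pred; _≤_; _<_; z≤n; s≤s; s≤s⁻¹;
         _≟_; _<?_; _≤?_; _≡ᵇ_; _≤ᵇ_; NonZero; >-nonZero)
open import Data.Nat.Combinatorics using (_C_; nCk+nC[k+1]≡[n+1]C[k+1])
open import Data.Nat.DivMod using (_%_; _mod_; m%n<n; m<n⇒m%n≡m)
open import Data.Nat.Induction using (<-rec)
open import Data.Nat.Properties
open import Data.Nat.Tactic.RingSolver using (solve-∀)
open import Algebra.Properties.CommutativeSemigroup +-commutativeSemigroup
  using () renaming (interchange to +-interchange)
open import Algebra.Properties.CommutativeSemigroup *-commutativeSemigroup
  using () renaming (interchange to *-interchange; x∙yz≈y∙xz to *-leftComm)
open import Data.Product using (Σ; ∃; ∃₂; _×_; _,_; proj₁; proj₂)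
open import Data.Sum using (_⊎_; inj₁; inj₂)
open import Data.Unit using (⊤; tt)
open import Data.Vec using (Vec; []; _∷_; here; there; lookup; tabulate)
open import Data.Vec.Properties using ([]=⇒lookup; lookup⇒[]=; lookup-map)
open import Function using (_∘_; case_of_; Equivalence)
open import Relation.Binary.PropositionalEquality
  using (_≡_; _≢_; refl; sym; trans; cong; cong₂; subst; module ≡-Reasoning)
open import Relation.Nullary using (¬_; yes; no; Dec; does; ¬?)
open import Relation.Nullary.Decidable using (True; toWitness; decidable-stable; dec-true; _×-dec_; _→-dec_)
open import Relation.Unary using (Decidable)

private
  variable
    n : ℕ

∣p∣≡1+∣p-x∣ : ∀ {p : Subset n} {x} → x ∈ p → ∣ p ∣ ≡ suc ∣ p - x ∣
∣p∣≡1+∣p-x∣ {p = inside  ∷ p} here        = cong suc (cong ∣_∣ (sym (p─⊥≡p p)))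
∣p∣≡1+∣p-x∣ {p = inside  ∷ p} (there x∈p) = cong suc (∣p∣≡1+∣p-x∣ x∈p)
∣p∣≡1+∣p-x∣ {p = outside ∷ p} (there x∈p) = ∣p∣≡1+∣p-x∣ x∈p

∣⁅x⁆∪p∣≡1+∣p∣ : ∀ {p : Subset n} {x} → x ∉ p → ∣ ⁅ x ⁆ ∪ p ∣ ≡ suc ∣ p ∣
∣⁅x⁆∪p∣≡1+∣p∣ {p = outside ∷ p} {zero}  _   = cong (λ q → suc ∣ q ∣) (∪-identityˡ p)
∣⁅x⁆∪p∣≡1+∣p∣ {p = inside  ∷ p} {zero}  x∉p = ⊥-elim (x∉p here)
∣⁅x⁆∪p∣≡1+∣p∣ {p = outside ∷ p} {suc x} x∉p = ∣⁅x⁆∪p∣≡1+∣p∣ (x∉p ∘ there)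
∣⁅x⁆∪p∣≡1+∣p∣ {p = inside  ∷ p} {suc x} x∉p = cong suc (∣⁅x⁆∪p∣≡1+∣p∣ (x∉p ∘ there))

∣p∣≤∣p─q∣+∣q∣ : ∀ (p q : Subset n) → ∣ p ∣ ≤ ∣ p ─ q ∣ + ∣ q ∣
∣p∣≤∣p─q∣+∣q∣ []            []            = z≤n
∣p∣≤∣p─q∣+∣q∣ (inside  ∷ p) (inside  ∷ q) = subst (suc ∣ p ∣ ≤_) (sym (+-suc _ _)) (s≤s (∣p∣≤∣p─q∣+∣q∣ p q))
∣p∣≤∣p─q∣+∣q∣ (outside ∷ p) (inside  ∷ q) = subst (∣ p ∣ ≤_) (sym (+-suc _ _)) (m≤n⇒m≤1+n (∣p∣≤∣p─q∣+∣q∣ p q))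
∣p∣≤∣p─q∣+∣q∣ (inside  ∷ p) (outside ∷ q) = s≤s (∣p∣≤∣p─q∣+∣q∣ p q)
∣p∣≤∣p─q∣+∣q∣ (outside ∷ p) (outside ∷ q) = ∣p∣≤∣p─q∣+∣q∣ p q

x∈p─q⇒x∉q : ∀ {p q : Subset n} {x} → x ∈ p ─ q → x ∉ q
x∈p─q⇒x∉q {p = _ ∷ _} {outside ∷ _} here            ()
x∈p─q⇒x∉q {p = _ ∷ p} {_ ∷ _}       (there x∈p─q) (there x∈q) = x∈p─q⇒x∉q {p = p} x∈p─q x∈q

nonempty : ∀ {p : Subset n} → 0 < ∣ p ∣ → Nonempty p
nonempty {p = inside  ∷ p} _       = zero , here
nonempty {p = outside ∷ p} 0<∣p∣ with nonempty 0<∣p∣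
... | x , x∈p = suc x , there x∈p

two-elements : ∀ {p : Subset n} → ∣ p ∣ ≡ 2 → ∃₂ λ x y → x ∈ p × y ∈ p × x ≢ y
two-elements {p = p} ∣p∣≡2 with nonempty {p = p} (subst (0 <_) (sym ∣p∣≡2) (s≤s z≤n))
... | x , x∈p
  with nonempty {p = p - x} (subst (0 <_) (suc-injective (trans (sym ∣p∣≡2) (∣p∣≡1+∣p-x∣ x∈p))) (s≤s z≤n))
...   | y , y∈p-x = x , y , x∈p , p─q⊆p p ⁅ x ⁆ y∈p-x , λ x≡y → x∉⁅y⁆⇒x≢y (x∈p─q⇒x∉q y∈p-x) (sym x≡y)

subset-of-size : ∀ (p : Subset n) {k} → k ≤ ∣ p ∣ → ∃ λ q → q ⊆ p × ∣ q ∣ ≡ k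
subset-of-size {n} p {zero} _ = ∅ , ⊆-min p , ∣⊥∣≡0 n
subset-of-size (outside ∷ p) {suc k} k<∣p∣ with subset-of-size p k<∣p∣
... | q , q⊆p , ∣q∣≡k = outside ∷ q , out⊆ q⊆p , ∣q∣≡k
subset-of-size (inside ∷ p) {suc k} (s≤s k≤∣p∣) with subset-of-size p k≤∣p∣
... | q , q⊆p , ∣q∣≡k = inside ∷ q , s⊆s q⊆p , cong suc ∣q∣≡k

injection⇒∣p∣≤∣q∣ : ∀ {m} {p : Subset n} {q : Subset m} (f : Fin n → Fin m) →
  (∀ {x} → x ∈ p → f x ∈ q) → (∀ {x y} → x ∈ p → y ∈ p → f x ≡ f y → x ≡ y) → ∣ p ∣ ≤ ∣ q ∣
injection⇒∣p∣≤∣q∣ {p = []} f into injective = z≤n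
injection⇒∣p∣≤∣q∣ {p = outside ∷ p} f into injective =
  injection⇒∣p∣≤∣q∣ (f ∘ suc) (into ∘ there) λ x∈p y∈p → Finₚ.suc-injective ∘ injective (there x∈p) (there y∈p)
injection⇒∣p∣≤∣q∣ {p = inside ∷ p} {q} f into injective =
  subst (suc ∣ p ∣ ≤_) (sym (∣p∣≡1+∣p-x∣ (into here))) (s≤s (injection⇒∣p∣≤∣q∣ (f ∘ suc) into′ injective′))
  where
  injective′ : ∀ {x y} → x ∈ p → y ∈ p → f (suc x) ≡ f (suc y) → x ≡ y
  injective′ x∈p y∈p = Finₚ.suc-injective ∘ injective (there x∈p) (there y∈p)
  into′ : ∀ {x} → x ∈ p → f (suc x) ∈ q - f zero
  into′ x∈p = x∈p∧x≢y⇒x∈p-y (into (there x∈p)) λ eq → case injective (there x∈p) here eq of λ ()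

lift-⁅x⁆∪p : ∀ {P : Fin n → Set} {x p} → P x → Lift P p → Lift P (⁅ x ⁆ ∪ p)
lift-⁅x⁆∪p {x = x} {p} Px Pp y∈ with x∈p∪q⁻ ⁅ x ⁆ p y∈
... | inj₁ y∈⁅x⁆ rewrite x∈⁅y⁆⇒x≡y x y∈⁅x⁆ = Px
... | inj₂ y∈p = Pp y∈p

-- Tournaments and orientations

IsTournament : (Fin n → Fin n → Bool) → Set
IsTournament T = ∀ {x y} → x ≢ y → T x y ≡ not (T y x)

IsTournamentOn : Subset n → (Fin n → Fin n → Bool) → Set
IsTournamentOn K T = ∀ {x y} → x ∈ K → y ∈ K → x ≢ y → T x y ≡ not (T y x)

transitiveTournament : Fin n → Fin n → Bool
transitiveTournament zero    zero    = false
transitiveTournament zero    (suc _) = true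
transitiveTournament (suc _) zero    = false
transitiveTournament (suc x) (suc y) = transitiveTournament x y

transitiveTournament-isTournament : IsTournament (transitiveTournament {n})
transitiveTournament-isTournament {x = zero}  {zero}  0≢0 = ⊥-elim (0≢0 refl)
transitiveTournament-isTournament {x = zero}  {suc y} _   = refl
transitiveTournament-isTournament {x = suc x} {zero}  _   = refl
transitiveTournament-isTournament {x = suc x} {suc y} x≢y =
  transitiveTournament-isTournament (x≢y ∘ cong suc)

extendFrom : Subset n → (Fin n → Fin n → Bool) → Fin n → Fin n → Bool
extendFrom K T x y with lookup K x | lookup K y
... | inside  | inside  = T x y
... | inside  | outside = true
... | outside | inside  = false
... | outside | outside = transitiveTournament x y

module _ {K : Subset n} {T : Fin n → Fin n → Bool} where

  extendFrom-isTournament : IsTournamentOn K T → IsTournament (extendFrom K T)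
  extendFrom-isTournament tournament {x} {y} x≢y
    with lookup K x in x∈K | lookup K y in y∈K
  ... | inside  | inside  = tournament (lookup⇒[]= x K x∈K) (lookup⇒[]= y K y∈K) x≢y
  ... | inside  | outside = refl
  ... | outside | inside  = refl
  ... | outside | outside = transitiveTournament-isTournament x≢y

  extendFrom-agrees : ∀ {x y} → x ∈ K → y ∈ K → extendFrom K T x y ≡ T x y
  extendFrom-agrees {x} {y} x∈K y∈K rewrite []=⇒lookup x∈K | []=⇒lookup y∈K = refl

  extendFrom-in-closed : ∀ {x y} → extendFrom K T x y ≡ true → y ∈ K → x ∈ K
  extendFrom-in-closed {x} {y} x→y y∈K with lookup K x in x∈K | lookup K y in y∈K′
  ... | inside  | _       = lookup⇒[]= x K x∈K
  ... | outside | outside = ⊥-elim (case trans (sym ([]=⇒lookup y∈K)) y∈K′ of λ ())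

adjacent⇒distinct : ∀ (G : Graph n) {u v} → Adj G u v ≡ true → u ≢ v
adjacent⇒distinct G {u} u~v refl = case trans (sym u~v) (irref G u) of λ ()

orientation : (G : Graph n) (T : Fin n → Fin n → Bool) → IsTournament T → Orientation G
orientation G T tournament = record
  { Arc      = λ u v → Adj G u v ∧ T u v
  ; arc-edge = arc⇒edge
  ; edge-arc = edge⇒arc
  }
  where
  arc⇒edge : ∀ u v → Adj G u v ∧ T u v ≡ true → Adj G u v ≡ true
  arc⇒edge u v = ∧-conicalˡ (Adj G u v) (T u v)

  edge⇒arc : ∀ u v → Adj G u v ≡ true →
             ((Adj G u v ∧ T u v ≡ true) × (Adj G v u ∧ T v u ≡ false)) ⊎
             ((Adj G u v ∧ T u v ≡ false) × (Adj G v u ∧ T v u ≡ true))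
  edge⇒arc u v u~v rewrite u~v | trans (Adj-sym G v u) u~v | tournament (adjacent⇒distinct G u~v)
    with T v u
  ... | true  = inj₂ (refl , refl)
  ... | false = inj₁ (refl , refl)

reverse-arc : ∀ {G : Graph n} (D : Orientation G) {u v} → Adj G u v ≡ true → Arc D u v ≢ true → Arc D v u ≡ true
reverse-arc D {u} {v} u~v u↛v with edge-arc D u v u~v
... | inj₁ (u→v , _) = ⊥-elim (u↛v u→v)
... | inj₂ (_ , v→u) = v→u

-- Forcing sets and forts

HasLeast : (ℕ → Set) → Set
HasLeast P = ∃ λ k → P k × (∀ i → P i → k ≤ i)

¬¬-least : ∀ {P : ℕ → Set} {j} → P j → ¬ ¬ HasLeast P
¬¬-least {P} {j} = <-rec (λ j → P j → ¬ ¬ HasLeast P) descend j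
  where
  descend : ∀ j → (∀ {i} → i < j → P i → ¬ ¬ HasLeast P) → P j → ¬ ¬ HasLeast P
  descend j below Pj no-least = no-least (j , Pj , λ i Pi → ≮⇒≥ λ i<j → below i<j Pi no-least)

module _ {G : Graph n} (D : Orientation G) where

  ¬¬forcingNumber : ¬ ¬ ∃ (IsForcingNumber D)
  ¬¬forcingNumber no-number = ¬¬-least everything-forces λ (f , forcing-set , least) →
    no-number (f , forcing-set , λ S forcing → least ∣ S ∣ (S , forcing , refl))
    where
    everything-forces : Σ (Subset n) λ S → IsForcingSet D S × ∣ S ∣ ≡ n
    everything-forces = full , (λ v → initial ∈⊤) , ∣⊤∣≡n n

  ForcesInto : Subset n → Fin n → Fin n → Set
  ForcesInto U u v = u ∉ U × v ∈ U × Arc D u v ≡ true × (∀ w → w ∈ U → Arc D u w ≡ true → w ≡ v)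

  Fort : Subset n → Set
  Fort U = ∀ {u v} → ¬ ForcesInto U u v

  forcesInto? : ∀ U → Dec (∃₂ (ForcesInto U))
  forcesInto? U = any? λ u → any? λ v →
    ¬? (u ∈? U) ×-dec v ∈? U ×-dec Arc D u v ≟ᵇ true ×-dec
    all? λ w → w ∈? U →-dec Arc D u w ≟ᵇ true →-dec w ≟ᶠ v

  module _ {S : Subset n} {U : Subset n} (U∩S≡∅ : ∀ {x} → x ∈ U → x ∉ S) where

    colored-avoids-fort : Fort U → ∀ {x} → Colored D S x → x ∉ U
    colored-avoids-fort no-force (initial x∈S) x∈U = U∩S≡∅ x∈U x∈S
    colored-avoids-fort no-force (force {u} {v} u-colored u→v others) v∈U =
      no-force (colored-avoids-fort no-force u-colored , v∈U , u→v , only-v)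
      where
      only-v : ∀ w → w ∈ U → Arc D u w ≡ true → w ≡ v
      only-v w w∈U u→w with w ≟ᶠ v
      ... | yes w≡v = w≡v
      ... | no  w≢v = ⊥-elim (colored-avoids-fort no-force (others w u→w w≢v) w∈U)

    forcing-into : IsForcingSet D S → Nonempty U → ∃₂ (ForcesInto U)
    forcing-into forcing (x , x∈U) with forcesInto? U
    ... | yes found = found
    ... | no  none  = ⊥-elim (colored-avoids-fort (λ f → none (_ , _ , f)) (forcing x) x∈U)

-- Dominated pairs

record Domination (T : Fin n → Fin n → Bool) (a b : ℕ) (P Q : Subset n) : Set where
  field
    A B       : Subset n
    A⊆P       : A ⊆ P
    B⊆Q       : B ⊆ Q
    ∣A∣≡a     : ∣ A ∣ ≡ a
    ∣B∣≡b     : ∣ B ∣ ≡ b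
    B-beats-A : ∀ {x y} → x ∈ B → y ∈ A → T x y ≡ true

Domination-mono : ∀ {T T′ : Fin n → Fin n → Bool} {a b} {P P′ Q Q′ : Subset n} →
  P ⊆ P′ → Q ⊆ Q′ → (∀ {x y} → x ∈ Q → y ∈ P → T x y ≡ true → T′ x y ≡ true) →
  Domination T a b P Q → Domination T′ a b P′ Q′
Domination-mono P⊆P′ Q⊆Q′ T⇒T′ d = record
  { A = A ; B = B ; A⊆P = P⊆P′ ∘ A⊆P ; B⊆Q = Q⊆Q′ ∘ B⊆Q ; ∣A∣≡a = ∣A∣≡a ; ∣B∣≡b = ∣B∣≡b
  ; B-beats-A = λ x∈B y∈A → T⇒T′ (B⊆Q x∈B) (A⊆P y∈A) (B-beats-A x∈B y∈A)
  }
  where open Domination d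

module Greedy {G : Graph n} (D : Orientation G) {K : Subset n} (clique : IsClique G K)
              (in-closed : ∀ {u v} → Arc D u v ≡ true → v ∈ K → u ∈ K)
              {S : Subset n} (forcing : IsForcingSet D S) (b : ℕ) where

  HasOutNeighbourIn : Subset n → Fin n → Set
  HasOutNeighbourIn U y = ∃ λ z → z ∈ U × Arc D y z ≡ true

  EscapingDomination : ℕ → Subset n → Set
  EscapingDomination a U = Σ (Domination (Arc D) a b K U) λ d → Lift (HasOutNeighbourIn U) (Domination.A d)

  add-forcer : ∀ {a U u v} → U ⊆ K → ForcesInto D U u v →
               EscapingDomination a (U - v) → EscapingDomination (suc a) U
  add-forcer {a} {U} {u} {v} U⊆K (u∉U , v∈U , u→v , only-v) (d , A-escapes) = record
    { A         = ⁅ u ⁆ ∪ A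
    ; B         = B
    ; A⊆P       = lift-⁅x⁆∪p u∈K A⊆P
    ; B⊆Q       = U-v⊆U ∘ B⊆Q
    ; ∣A∣≡a     = trans (∣⁅x⁆∪p∣≡1+∣p∣ u∉A) (cong suc ∣A∣≡a)
    ; ∣B∣≡b     = ∣B∣≡b
    ; B-beats-A = λ x∈B → lift-⁅x⁆∪p (beats-u (B⊆Q x∈B)) (B-beats-A x∈B)
    } , lift-⁅x⁆∪p (v , v∈U , u→v) λ y∈A → let z , z∈U-v , y→z = A-escapes y∈A in z , U-v⊆U z∈U-v , y→z
    where
    open Domination d
    U-v⊆U : U - v ⊆ U
    U-v⊆U = p─q⊆p U ⁅ v ⁆
    u∈K : u ∈ K
    u∈K = in-closed u→v (U⊆K v∈U)
    ≢v : ∀ {x} → x ∈ U - v → x ≢ v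
    ≢v = x∉⁅y⁆⇒x≢y ∘ x∈p─q⇒x∉q
    u∉A : u ∉ A
    u∉A u∈A = let z , z∈U-v , u→z = A-escapes u∈A in ≢v z∈U-v (only-v z (U-v⊆U z∈U-v) u→z)
    beats-u : ∀ {x} → x ∈ U - v → Arc D x u ≡ true
    beats-u {x} x∈U-v = reverse-arc D (clique u x u∈K (U⊆K x∈U) u≢x) λ u→x → ≢v x∈U-v (only-v x x∈U u→x)
      where
      x∈U = U-v⊆U x∈U-v
      u≢x : u ≢ x
      u≢x refl = u∉U x∈U

  greedy : ∀ a {U} → U ⊆ K ─ S → a + b ≤ ∣ U ∣ → EscapingDomination a U
  greedy zero {U} _ b≤∣U∣ with subset-of-size U b≤∣U∣
  ... | B , B⊆U , ∣B∣≡b = record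
    { A = ∅ ; B = B ; A⊆P = ⊆-min K ; B⊆Q = B⊆U ; ∣A∣≡a = ∣⊥∣≡0 n ; ∣B∣≡b = ∣B∣≡b
    ; B-beats-A = λ _ → ⊥-elim ∘ ∉⊥
    } , ⊥-elim ∘ ∉⊥
  greedy (suc a) {U} U⊆K─S 1+a+b≤∣U∣
    with forcing-into D (x∈p─q⇒x∉q ∘ U⊆K─S) forcing (nonempty (<-≤-trans (s≤s z≤n) 1+a+b≤∣U∣))
  ... | u , v , forces@(_ , v∈U , _) =
    add-forcer (p─q⊆p K S ∘ U⊆K─S) forces
      (greedy a (U⊆K─S ∘ p─q⊆p U ⁅ v ⁆) (s≤s⁻¹ (subst (suc a + b ≤_) (∣p∣≡1+∣p-x∣ v∈U) 1+a+b≤∣U∣)))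

DominationFree : Subset n → ℕ → ℕ → Set
DominationFree {n} K a b = ∃ λ (T : Fin n → Fin n → Bool) → IsTournamentOn K T × ¬ Domination T a b K K

∣K∣∸m<a+b : ∀ {G : Graph n} {m K a b} → IsMOF G m → IsClique G K → DominationFree K a b → ∣ K ∣ ∸ m < a + b
∣K∣∸m<a+b {G = G} {m} {K} {a} {b} mof clique (T , tournament , free) =
  -- Being a forcing set is not decided here, so a least one only exists under ¬ ¬;
  -- the conclusion is decidable, which removes the double negation.
  decidable-stable (∣ K ∣ ∸ m <? a + b) λ excess≮a+b → ¬¬forcingNumber D (refute (≮⇒≥ excess≮a+b))
  where
  D = orientation G (extendFrom K T) (extendFrom-isTournament tournament)

  extended-arc : ∀ {u v} → Arc D u v ≡ true → extendFrom K T u v ≡ true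
  extended-arc {u} {v} = ∧-conicalʳ (Adj G u v) _

  refute : a + b ≤ ∣ K ∣ ∸ m → ¬ ∃ (IsForcingNumber D)
  refute a+b≤excess (f , isF@((S , forcing , ∣S∣≡f) , _)) =
    free (Domination-mono ⊆-refl (p─q⊆p K S) agrees (proj₁ (greedy a ⊆-refl a+b≤∣K─S∣)))
    where
    open Greedy D clique (λ u→v → extendFrom-in-closed (extended-arc u→v)) forcing b
    ∣S∣≤m : ∣ S ∣ ≤ m
    ∣S∣≤m = subst (_≤ m) (sym ∣S∣≡f) (proj₂ mof D f isF)
    a+b≤∣K─S∣ : a + b ≤ ∣ K ─ S ∣
    a+b≤∣K─S∣ = ≤-trans a+b≤excess (m≤n+o⇒m∸n≤o ∣ K ∣ m (begin
      ∣ K ∣             ≤⟨ ∣p∣≤∣p─q∣+∣q∣ K S ⟩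
      ∣ K ─ S ∣ + ∣ S ∣ ≤⟨ +-monoʳ-≤ ∣ K ─ S ∣ ∣S∣≤m ⟩
      ∣ K ─ S ∣ + m     ≡⟨ +-comm ∣ K ─ S ∣ m ⟩
      m + ∣ K ─ S ∣     ∎))
      where open ≤-Reasoning
    agrees : ∀ {x y} → x ∈ K ─ S → y ∈ K → Arc D x y ≡ true → T x y ≡ true
    agrees x∈K─S y∈K x→y = trans (sym (extendFrom-agrees (p─q⊆p K S x∈K─S) y∈K)) (extended-arc x→y)

-- Counting tournaments

∑ˢ : (Subset n → ℕ) → ℕ
∑ˢ {zero}  f = f []
∑ˢ {suc n} f = ∑ˢ (f ∘ (outside ∷_)) + ∑ˢ (f ∘ (inside ∷_))

∑ˢ-cong : ∀ {f g : Subset n → ℕ} → (∀ p → f p ≡ g p) → ∑ˢ f ≡ ∑ˢ g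
∑ˢ-cong {zero}  f≡g = f≡g []
∑ˢ-cong {suc n} f≡g = cong₂ _+_ (∑ˢ-cong (f≡g ∘ (outside ∷_))) (∑ˢ-cong (f≡g ∘ (inside ∷_)))

∑ˢ-mono : ∀ {f g : Subset n → ℕ} → (∀ p → f p ≤ g p) → ∑ˢ f ≤ ∑ˢ g
∑ˢ-mono {zero}  f≤g = f≤g []
∑ˢ-mono {suc n} f≤g = +-mono-≤ (∑ˢ-mono (f≤g ∘ (outside ∷_))) (∑ˢ-mono (f≤g ∘ (inside ∷_)))

∑ˢ-+ : ∀ (f g : Subset n → ℕ) → ∑ˢ (λ p → f p + g p) ≡ ∑ˢ f + ∑ˢ g
∑ˢ-+ {zero}  f g = refl
∑ˢ-+ {suc n} f g = begin
  ∑ˢ (λ p → f (outside ∷ p) + g (outside ∷ p)) + ∑ˢ (λ p → f (inside ∷ p) + g (inside ∷ p))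
    ≡⟨ cong₂ _+_ (∑ˢ-+ (f ∘ (outside ∷_)) (g ∘ (outside ∷_))) (∑ˢ-+ (f ∘ (inside ∷_)) (g ∘ (inside ∷_))) ⟩
  (∑ˢ (f ∘ (outside ∷_)) + ∑ˢ (g ∘ (outside ∷_))) + (∑ˢ (f ∘ (inside ∷_)) + ∑ˢ (g ∘ (inside ∷_)))
    ≡⟨ +-interchange (∑ˢ (f ∘ (outside ∷_))) (∑ˢ (g ∘ (outside ∷_)))
                     (∑ˢ (f ∘ (inside ∷_))) (∑ˢ (g ∘ (inside ∷_))) ⟩
  (∑ˢ (f ∘ (outside ∷_)) + ∑ˢ (f ∘ (inside ∷_))) + (∑ˢ (g ∘ (outside ∷_)) + ∑ˢ (g ∘ (inside ∷_))) ∎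
  where open ≡-Reasoning

∑ˢ-*ˡ : ∀ c (f : Subset n → ℕ) → ∑ˢ (λ p → c * f p) ≡ c * ∑ˢ f
∑ˢ-*ˡ {zero}  c f = refl
∑ˢ-*ˡ {suc n} c f = trans (cong₂ _+_ (∑ˢ-*ˡ c (f ∘ (outside ∷_))) (∑ˢ-*ˡ c (f ∘ (inside ∷_))))
                          (sym (*-distribˡ-+ c _ _))

∑ˢ-*ʳ : ∀ (f : Subset n → ℕ) c → ∑ˢ (λ p → f p * c) ≡ ∑ˢ f * c
∑ˢ-*ʳ f c = trans (∑ˢ-cong (λ p → *-comm (f p) c)) (trans (∑ˢ-*ˡ c f) (*-comm c (∑ˢ f)))

∑ˢ-const : ∀ n c → ∑ˢ {n} (λ _ → c) ≡ 2 ^ n * c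
∑ˢ-const zero    c = sym (+-identityʳ c)
∑ˢ-const (suc n) c = begin
  ∑ˢ {n} (λ _ → c) + ∑ˢ {n} (λ _ → c) ≡⟨ cong₂ _+_ (∑ˢ-const n c) (∑ˢ-const n c) ⟩
  2 ^ n * c + 2 ^ n * c               ≡⟨ cong (2 ^ n * c +_) (sym (+-identityʳ _)) ⟩
  2 * (2 ^ n * c)                     ≡⟨ *-assoc 2 (2 ^ n) c ⟨
  2 ^ suc n * c                       ∎
  where open ≡-Reasoning

∑ˢ-zero : ∀ n → ∑ˢ {n} (λ _ → 0) ≡ 0
∑ˢ-zero n = ∑ˢ-*ˡ {n} 0 (λ _ → 0)

∑ˢ-term : ∀ (f : Subset n → ℕ) p → f p ≤ ∑ˢ f
∑ˢ-term f []            = ≤-refl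
∑ˢ-term f (outside ∷ p) = ≤-trans (∑ˢ-term (f ∘ (outside ∷_)) p) (m≤m+n _ _)
∑ˢ-term f (inside  ∷ p) = ≤-trans (∑ˢ-term (f ∘ (inside ∷_)) p) (m≤n+m _ _)

∑ˢ-swap : ∀ {m} (f : Subset n → Subset m → ℕ) → ∑ˢ (λ p → ∑ˢ (f p)) ≡ ∑ˢ (λ q → ∑ˢ λ p → f p q)
∑ˢ-swap {zero}  f = refl
∑ˢ-swap {suc n} f = trans (cong₂ _+_ (∑ˢ-swap (f ∘ (outside ∷_))) (∑ˢ-swap (f ∘ (inside ∷_))))
                          (sym (∑ˢ-+ (λ q → ∑ˢ λ p → f (outside ∷ p) q) (λ q → ∑ˢ λ p → f (inside ∷ p) q)))

∑ˢ-∁ : ∀ (f : Subset n → ℕ) → ∑ˢ (f ∘ ∁) ≡ ∑ˢ f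
∑ˢ-∁ {zero}  f = refl
∑ˢ-∁ {suc n} f = trans (+-comm (∑ˢ (f ∘ (inside ∷_) ∘ ∁)) (∑ˢ (f ∘ (outside ∷_) ∘ ∁)))
                       (cong₂ _+_ (∑ˢ-∁ (f ∘ (outside ∷_))) (∑ˢ-∁ (f ∘ (inside ∷_))))

∑ˢ-< : ∀ {f g : Subset n → ℕ} → ∑ˢ f < ∑ˢ g → ∃ λ p → f p < g p
∑ˢ-< {zero} f<g = [] , f<g
∑ˢ-< {suc n} {f} {g} f<g with ∑ˢ (f ∘ (outside ∷_)) <? ∑ˢ (g ∘ (outside ∷_))
... | yes f₀<g₀ = let p , fp<gp = ∑ˢ-< f₀<g₀ in outside ∷ p , fp<gp
... | no  f₀≮g₀ =
  let p , fp<gp = ∑ˢ-< (+-cancelˡ-< _ _ _ (≤-<-trans (+-monoˡ-≤ _ (≮⇒≥ f₀≮g₀)) f<g)) in inside ∷ p , fp<gp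

-- A tournament on Fin (suc n) is coded by the out-neighbourhood of vertex zero
-- together with a tournament on the remaining vertices.
Tournament : ℕ → Set
Tournament zero    = ⊤
Tournament (suc n) = Subset n × Tournament n

arc : Tournament n → Fin n → Fin n → Bool
arc {suc n} (r , t) zero    zero    = false
arc {suc n} (r , t) zero    (suc j) = lookup r j
arc {suc n} (r , t) (suc i) zero    = not (lookup r i)
arc {suc n} (r , t) (suc i) (suc j) = arc t i j

arc-isTournament : (t : Tournament n) → IsTournament (arc t)
arc-isTournament {suc n} (r , t) {zero}  {zero}  0≢0 = ⊥-elim (0≢0 refl)
arc-isTournament {suc n} (r , t) {zero}  {suc j} _   = sym (not-involutive _)
arc-isTournament {suc n} (r , t) {suc i} {zero}  _   = refl
arc-isTournament {suc n} (r , t) {suc i} {suc j} i≢j = arc-isTournament t (i≢j ∘ cong suc)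

∑ᵗ : (Tournament n → ℕ) → ℕ
∑ᵗ {zero}  f = f tt
∑ᵗ {suc n} f = ∑ˢ λ r → ∑ᵗ λ t → f (r , t)

∑ᵗ-cong : ∀ {f g : Tournament n → ℕ} → (∀ t → f t ≡ g t) → ∑ᵗ f ≡ ∑ᵗ g
∑ᵗ-cong {zero}  f≡g = f≡g tt
∑ᵗ-cong {suc n} f≡g = ∑ˢ-cong λ r → ∑ᵗ-cong λ t → f≡g (r , t)

∑ᵗ-*ˡ : ∀ c (f : Tournament n → ℕ) → ∑ᵗ (λ t → c * f t) ≡ c * ∑ᵗ f
∑ᵗ-*ˡ {zero}  c f = refl
∑ᵗ-*ˡ {suc n} c f = trans (∑ˢ-cong λ r → ∑ᵗ-*ˡ c (λ t → f (r , t))) (∑ˢ-*ˡ c λ r → ∑ᵗ λ t → f (r , t))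

∑ᵗ-zero : ∀ n → ∑ᵗ {n} (λ _ → 0) ≡ 0
∑ᵗ-zero n = ∑ᵗ-*ˡ {n} 0 (λ _ → 0)

∑ᵗ-swap : ∀ {m} (f : Tournament n → Subset m → ℕ) → ∑ᵗ (λ t → ∑ˢ (f t)) ≡ ∑ˢ (λ p → ∑ᵗ λ t → f t p)
∑ᵗ-swap {zero}  f = refl
∑ᵗ-swap {suc n} f = trans (∑ˢ-cong λ r → ∑ᵗ-swap (λ t → f (r , t))) (∑ˢ-swap λ r p → ∑ᵗ λ t → f (r , t) p)

∑ᵗ-< : ∀ {f g : Tournament n → ℕ} → ∑ᵗ f < ∑ᵗ g → ∃ λ t → f t < g t
∑ᵗ-< {zero}  f<g = tt , f<g
∑ᵗ-< {suc n} f<g with ∑ˢ-< f<g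
... | r , f<g′ with ∑ᵗ-< f<g′
...   | t , ft<gt = (r , t) , ft<gt

#T : ℕ → ℕ
#T n = ∑ᵗ {n} (λ _ → 1)

#T-suc : ∀ n → #T (suc n) ≡ 2 ^ n * #T n
#T-suc n = ∑ˢ-const n (#T n)

#T-pos : ∀ n → 0 < #T n
#T-pos zero    = s≤s z≤n
#T-pos (suc n) = <-≤-trans (#T-pos n) (∑ˢ-term {n} (λ _ → #T n) ∅)

[_] : Bool → ℕ
[ true  ] = 1
[ false ] = 0

[∧] : ∀ x y → [ x ∧ y ] ≡ [ x ] * [ y ]
[∧] true  y = sym (+-identityʳ [ y ])
[∧] false y = refl

chooses : Subset n → ℕ → Subset n → Bool
chooses K k A = (∣ A ∣ ≡ᵇ k) ∧ does (A ⊆? K)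

chooses⇒∣A∣≡k : ∀ (K : Subset n) k A → chooses K k A ≡ true → ∣ A ∣ ≡ k
chooses⇒∣A∣≡k K k A chosen = ≡ᵇ⇒≡ ∣ A ∣ k (Equivalence.from T-≡ (∧-conicalˡ _ _ chosen))

chooses-complete : ∀ {K : Subset n} {k A} → A ⊆ K → ∣ A ∣ ≡ k → chooses K k A ≡ true
chooses-complete {K = K} {k} {A} A⊆K ∣A∣≡k =
  cong₂ _∧_ (Equivalence.to T-≡ (≡⇒≡ᵇ ∣ A ∣ k ∣A∣≡k)) (dec-true (A ⊆? K) A⊆K)

∑ˢ-chooses : ∀ (K : Subset n) k → ∑ˢ (λ A → [ chooses K k A ]) ≡ ∣ K ∣ C k
∑ˢ-chooses []                zero    = refl
∑ˢ-chooses []                (suc k) = refl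
∑ˢ-chooses {suc n} (outside ∷ K) k   = begin
  ∑ˢ (λ A → [ chooses K k A ]) + ∑ˢ {n} (λ A → [ (suc ∣ A ∣ ≡ᵇ k) ∧ false ])
    ≡⟨ cong₂ _+_ (∑ˢ-chooses K k) (trans (∑ˢ-cong {n} λ A → cong [_] (∧-zeroʳ (suc ∣ A ∣ ≡ᵇ k))) (∑ˢ-zero n)) ⟩
  ∣ K ∣ C k + 0
    ≡⟨ +-identityʳ _ ⟩
  ∣ K ∣ C k ∎
  where open ≡-Reasoning
∑ˢ-chooses {suc n} (inside ∷ K) zero    = trans (cong₂ _+_ (∑ˢ-chooses K 0) (∑ˢ-zero n)) (+-identityʳ _)
∑ˢ-chooses {suc n} (inside ∷ K) (suc k) = begin
  ∑ˢ (λ A → [ chooses K (suc k) A ]) + ∑ˢ (λ A → [ chooses K k A ])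
    ≡⟨ cong₂ _+_ (∑ˢ-chooses K (suc k)) (∑ˢ-chooses K k) ⟩
  ∣ K ∣ C suc k + ∣ K ∣ C k
    ≡⟨ +-comm (∣ K ∣ C suc k) (∣ K ∣ C k) ⟩
  ∣ K ∣ C k + ∣ K ∣ C suc k
    ≡⟨ nCk+nC[k+1]≡[n+1]C[k+1] ∣ K ∣ k ⟩
  suc ∣ K ∣ C suc k ∎
  where open ≡-Reasoning

∑ˢ-supersets : ∀ (M : Subset n) → ∑ˢ (λ r → [ does (M ⊆? r) ]) * 2 ^ ∣ M ∣ ≡ 2 ^ n
∑ˢ-supersets []                    = refl
∑ˢ-supersets {suc n} (outside ∷ M) = begin
  (S + S) * 2 ^ ∣ M ∣             ≡⟨ *-distribʳ-+ (2 ^ ∣ M ∣) S S ⟩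
  S * 2 ^ ∣ M ∣ + S * 2 ^ ∣ M ∣   ≡⟨ cong₂ _+_ (∑ˢ-supersets M) (∑ˢ-supersets M) ⟩
  2 ^ n + 2 ^ n                   ≡⟨ cong (2 ^ n +_) (+-identityʳ (2 ^ n)) ⟨
  2 ^ suc n                       ∎
  where
  open ≡-Reasoning
  S = ∑ˢ (λ r → [ does (M ⊆? r) ])
∑ˢ-supersets {suc n} (inside ∷ M)  = begin
  (∑ˢ {n} (λ _ → 0) + S) * (2 * 2 ^ ∣ M ∣) ≡⟨ cong (λ z → (z + S) * (2 * 2 ^ ∣ M ∣)) (∑ˢ-zero n) ⟩
  S * (2 * 2 ^ ∣ M ∣)                     ≡⟨ *-leftComm S 2 (2 ^ ∣ M ∣) ⟩
  2 * (S * 2 ^ ∣ M ∣)                     ≡⟨ cong (2 *_) (∑ˢ-supersets M) ⟩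
  2 ^ suc n                               ∎
  where
  open ≡-Reasoning
  S = ∑ˢ (λ r → [ does (M ⊆? r) ])

∑ˢ-disjoint : ∀ (M : Subset n) → ∑ˢ (λ r → [ does (M ⊆? ∁ r) ]) * 2 ^ ∣ M ∣ ≡ 2 ^ n
∑ˢ-disjoint M = trans (cong (_* 2 ^ ∣ M ∣) (∑ˢ-∁ λ r → [ does (M ⊆? r) ])) (∑ˢ-supersets M)

-- The condition on the arcs at vertex zero for B to beat A, given whether zero lies
-- in B and in A: if zero ∈ B it must beat all of A, if zero ∈ A all of B must beat it.
beatsRow : Subset n → Side → Side → Subset n → Subset n → Bool
beatsRow r inside  inside  B A = false
beatsRow r inside  outside B A = does (A ⊆? r)
beatsRow r outside inside  B A = does (B ⊆? ∁ r)
beatsRow r outside outside B A = true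

beats : Tournament n → Subset n → Subset n → Bool
beats {zero}  _       []      []      = true
beats {suc n} (r , t) (x ∷ B) (y ∷ A) = beatsRow r x y B A ∧ beats t B A

beats-complete : ∀ (t : Tournament n) B A → (∀ {x y} → x ∈ B → y ∈ A → arc t x y ≡ true) → beats t B A ≡ true
beats-complete {zero}  _       []      []      _        = refl
beats-complete {suc n} (r , t) (x ∷ B) (y ∷ A) B-beats-A =
  cong₂ _∧_ (row x y refl refl) (beats-complete t B A λ x∈B y∈A → B-beats-A (there x∈B) (there y∈A))
  where
  row : ∀ x′ y′ → x ≡ x′ → y ≡ y′ → beatsRow r x′ y′ B A ≡ true
  row inside  inside  refl refl = case B-beats-A here here of λ ()
  row inside  outside refl refl = dec-true (A ⊆? r) λ {j} j∈A → lookup⇒[]= j r (B-beats-A here (there j∈A))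
  row outside inside  refl refl = dec-true (B ⊆? ∁ r) λ {j} j∈B →
    lookup⇒[]= j (∁ r) (trans (lookup-map j not r) (B-beats-A (there j∈B) here))
  row outside outside refl refl = refl

∑ᵗ-beats-split : ∀ x y (B A : Subset n) →
  ∑ᵗ (λ t → [ beats t (x ∷ B) (y ∷ A) ]) ≡ ∑ˢ (λ r → [ beatsRow r x y B A ]) * ∑ᵗ (λ t → [ beats t B A ])
∑ᵗ-beats-split x y B A = trans
  (∑ˢ-cong λ r → trans (∑ᵗ-cong λ t → [∧] (beatsRow r x y B A) (beats t B A))
                       (∑ᵗ-*ˡ [ beatsRow r x y B A ] λ t → [ beats t B A ]))
  (∑ˢ-*ʳ (λ r → [ beatsRow r x y B A ]) (∑ᵗ λ t → [ beats t B A ]))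

count-beats : ∀ (B A : Subset n) → ∑ᵗ (λ t → [ beats t B A ]) * 2 ^ (∣ B ∣ * ∣ A ∣) ≤ #T n
count-beats {zero}  []      []      = ≤-refl
count-beats {suc n} (x ∷ B) (y ∷ A) =
  ≤-trans (≤-reflexive (cong (_* 2 ^ (∣ x ∷ B ∣ * ∣ y ∷ A ∣)) (∑ᵗ-beats-split x y B A))) (row-bound x y)
  where
  S = ∑ᵗ (λ t → [ beats t B A ])

  from-row : ∀ R k {e} → R * 2 ^ k ≡ 2 ^ n → e ≡ k + ∣ B ∣ * ∣ A ∣ → R * S * 2 ^ e ≤ #T (suc n)
  from-row R k R*2ᵏ≡2ⁿ refl = begin
    R * S * 2 ^ (k + ∣ B ∣ * ∣ A ∣)         ≡⟨ cong (R * S *_) (^-distribˡ-+-* 2 k (∣ B ∣ * ∣ A ∣)) ⟩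
    R * S * (2 ^ k * 2 ^ (∣ B ∣ * ∣ A ∣))   ≡⟨ *-interchange R S (2 ^ k) (2 ^ (∣ B ∣ * ∣ A ∣)) ⟩
    R * 2 ^ k * (S * 2 ^ (∣ B ∣ * ∣ A ∣))   ≡⟨ cong (_* (S * 2 ^ (∣ B ∣ * ∣ A ∣))) R*2ᵏ≡2ⁿ ⟩
    2 ^ n * (S * 2 ^ (∣ B ∣ * ∣ A ∣))       ≤⟨ *-monoʳ-≤ (2 ^ n) (count-beats B A) ⟩
    2 ^ n * #T n                            ≡⟨ #T-suc n ⟨
    #T (suc n)                              ∎
    where open ≤-Reasoning

  row-bound : ∀ x y → ∑ˢ (λ r → [ beatsRow r x y B A ]) * S * 2 ^ (∣ x ∷ B ∣ * ∣ y ∷ A ∣) ≤ #T (suc n)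
  row-bound inside  inside  =
    ≤-trans (≤-reflexive (cong (λ R → R * S * 2 ^ (suc ∣ B ∣ * suc ∣ A ∣)) (∑ˢ-zero n))) z≤n
  row-bound inside  outside = from-row (∑ˢ λ r → [ does (A ⊆? r) ]) ∣ A ∣ (∑ˢ-supersets A) refl
  row-bound outside inside  = from-row (∑ˢ λ r → [ does (B ⊆? ∁ r) ]) ∣ B ∣ (∑ˢ-disjoint B) (*-suc ∣ B ∣ ∣ A ∣)
  row-bound outside outside = from-row (∑ˢ {n} (λ _ → 1)) 0
    (trans (*-identityʳ _) (trans (∑ˢ-const n 1) (*-identityʳ (2 ^ n)))) refl

module _ (K : Subset n) (a b : ℕ) where

  candidate : Tournament n → Subset n → Subset n → Bool
  candidate t A B = chooses K a A ∧ chooses K b B ∧ beats t B A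

  dominations : Tournament n → ℕ
  dominations t = ∑ˢ λ A → ∑ˢ λ B → [ candidate t A B ]

  domination⇒1≤dominations : ∀ t → Domination (arc t) a b K K → 1 ≤ dominations t
  domination⇒1≤dominations t d = begin
    1                              ≡⟨ cong [_] candidate-AB ⟨
    [ candidate t A B ]            ≤⟨ ∑ˢ-term (λ B → [ candidate t A B ]) B ⟩
    ∑ˢ (λ B → [ candidate t A B ]) ≤⟨ ∑ˢ-term (λ A → ∑ˢ λ B → [ candidate t A B ]) A ⟩
    dominations t                  ∎
    where
    open Domination d
    open ≤-Reasoning
    candidate-AB : candidate t A B ≡ true
    candidate-AB = cong₂ _∧_ (chooses-complete A⊆P ∣A∣≡a)
                     (cong₂ _∧_ (chooses-complete B⊆Q ∣B∣≡b) (beats-complete t B A B-beats-A))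

  pair-bound : ∀ A B →
    ∑ᵗ (λ t → [ candidate t A B ]) * 2 ^ (b * a) ≤ [ chooses K a A ] * ([ chooses K b B ] * #T n)
  pair-bound A B with chooses K a A in chosen-A | chooses K b B in chosen-B
  ... | false | _     = ≤-reflexive (cong (_* 2 ^ (b * a)) (∑ᵗ-zero n))
  ... | true  | false = ≤-reflexive (cong (_* 2 ^ (b * a)) (∑ᵗ-zero n))
  ... | true  | true  = begin
    ∑ᵗ (λ t → [ beats t B A ]) * 2 ^ (b * a)
      ≡⟨ cong (λ e → ∑ᵗ (λ t → [ beats t B A ]) * 2 ^ e) ∣B∣*∣A∣≡b*a ⟨
    ∑ᵗ (λ t → [ beats t B A ]) * 2 ^ (∣ B ∣ * ∣ A ∣)
      ≤⟨ count-beats B A ⟩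
    #T n
      ≡⟨ trans (*-identityˡ _) (*-identityˡ _) ⟨
    1 * (1 * #T n) ∎
    where
    open ≤-Reasoning
    ∣B∣*∣A∣≡b*a = cong₂ _*_ (chooses⇒∣A∣≡k K b B chosen-B) (chooses⇒∣A∣≡k K a A chosen-A)

  ∑ᵗ-dominations-bound : ∑ᵗ dominations * 2 ^ (b * a) ≤ (∣ K ∣ C a) * ((∣ K ∣ C b) * #T n)
  ∑ᵗ-dominations-bound = begin
    ∑ᵗ dominations * 2 ^ (b * a)
      ≡⟨ cong (_* 2 ^ (b * a)) (trans (∑ᵗ-swap λ t A → ∑ˢ λ B → [ candidate t A B ])
                                      (∑ˢ-cong λ A → ∑ᵗ-swap λ t B → [ candidate t A B ])) ⟩
    ∑ˢ (λ A → ∑ˢ λ B → ∑ᵗ λ t → [ candidate t A B ]) * 2 ^ (b * a)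
      ≡⟨ trans (∑ˢ-cong λ A → ∑ˢ-*ʳ (λ B → ∑ᵗ λ t → [ candidate t A B ]) _)
               (∑ˢ-*ʳ (λ A → ∑ˢ λ B → ∑ᵗ λ t → [ candidate t A B ]) _) ⟨
    ∑ˢ (λ A → ∑ˢ λ B → ∑ᵗ (λ t → [ candidate t A B ]) * 2 ^ (b * a))
      ≤⟨ ∑ˢ-mono (λ A → ∑ˢ-mono λ B → pair-bound A B) ⟩
    ∑ˢ (λ A → ∑ˢ λ B → [ chooses K a A ] * ([ chooses K b B ] * #T n))
      ≡⟨ ∑ˢ-cong (λ A → trans (∑ˢ-*ˡ [ chooses K a A ] λ B → [ chooses K b B ] * #T n)
                             (cong ([ chooses K a A ] *_) (∑ˢ-*ʳ (λ B → [ chooses K b B ]) (#T n)))) ⟩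
    ∑ˢ (λ A → [ chooses K a A ] * (∑ˢ (λ B → [ chooses K b B ]) * #T n))
      ≡⟨ ∑ˢ-*ʳ (λ A → [ chooses K a A ]) (∑ˢ (λ B → [ chooses K b B ]) * #T n) ⟩
    ∑ˢ (λ A → [ chooses K a A ]) * (∑ˢ (λ B → [ chooses K b B ]) * #T n)
      ≡⟨ cong₂ (λ x y → x * (y * #T n)) (∑ˢ-chooses K a) (∑ˢ-chooses K b) ⟩
    (∣ K ∣ C a) * ((∣ K ∣ C b) * #T n) ∎
    where open ≤-Reasoning

domination-free-by-counting : ∀ (K : Subset n) {a b} →
  (∣ K ∣ C a) * (∣ K ∣ C b) < 2 ^ (a * b) → DominationFree K a b
domination-free-by-counting {n} K {a} {b} few
  with ∑ᵗ-< {f = dominations K a b} {g = λ _ → 1} ∑ᵗ-dominations<#T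
  where
  instance
    #T≢0 : NonZero (#T n)
    #T≢0 = >-nonZero (#T-pos n)
  ∑ᵗ-dominations<#T : ∑ᵗ (dominations K a b) < #T n
  ∑ᵗ-dominations<#T = *-cancelʳ-< (2 ^ (b * a)) _ _ (begin-strict
    ∑ᵗ (dominations K a b) * 2 ^ (b * a) ≤⟨ ∑ᵗ-dominations-bound K a b ⟩
    (∣ K ∣ C a) * ((∣ K ∣ C b) * #T n)   ≡⟨ *-assoc (∣ K ∣ C a) (∣ K ∣ C b) (#T n) ⟨
    (∣ K ∣ C a) * (∣ K ∣ C b) * #T n     <⟨ *-monoˡ-< (#T n) few ⟩
    2 ^ (a * b) * #T n                   ≡⟨ cong (λ e → 2 ^ e * #T n) (*-comm a b) ⟩
    2 ^ (b * a) * #T n                   ≡⟨ *-comm (2 ^ (b * a)) (#T n) ⟩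
    #T n * 2 ^ (b * a)                   ∎)
    where open ≤-Reasoning
... | t , no-domination = arc t , (λ _ _ → arc-isTournament t) ,
  λ d → <⇒≱ no-domination (domination⇒1≤dominations K a b t d)

-- Explicit tournaments

rank : Subset n → Fin n → ℕ
rank (_       ∷ K) zero    = 0
rank (inside  ∷ K) (suc x) = suc (rank K x)
rank (outside ∷ K) (suc x) = rank K x

rank<∣K∣ : ∀ {K : Subset n} {x} → x ∈ K → rank K x < ∣ K ∣
rank<∣K∣ {K = inside  ∷ K} here        = s≤s z≤n
rank<∣K∣ {K = inside  ∷ K} (there x∈K) = s≤s (rank<∣K∣ x∈K)
rank<∣K∣ {K = outside ∷ K} (there x∈K) = rank<∣K∣ x∈K

rank-injective : ∀ {K : Subset n} {x y} → x ∈ K → y ∈ K → rank K x ≡ rank K y → x ≡ y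
rank-injective {K = inside  ∷ K} here        here        _  = refl
rank-injective {K = inside  ∷ K} (there x∈K) (there y∈K) eq =
  cong suc (rank-injective x∈K y∈K (suc-injective eq))
rank-injective {K = outside ∷ K} (there x∈K) (there y∈K) eq = cong suc (rank-injective x∈K y∈K eq)

module _ (K : Subset n) {p} .{{_ : NonZero p}} (∣K∣≤p : ∣ K ∣ ≤ p) where

  -- Reducing modulo p only matters outside K, where the rank may exceed p.
  embed : Fin n → Fin p
  embed x = rank K x mod p

  embed-injective : ∀ {x y} → x ∈ K → y ∈ K → embed x ≡ embed y → x ≡ y
  embed-injective {x} {y} x∈K y∈K eq = rank-injective x∈K y∈K (begin
    rank K x               ≡⟨ m<n⇒m%n≡m (<-≤-trans (rank<∣K∣ x∈K) ∣K∣≤p) ⟨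
    rank K x % p           ≡⟨ toℕ-fromℕ< (m%n<n (rank K x) p) ⟨
    toℕ (embed x)          ≡⟨ cong toℕ eq ⟩
    toℕ (embed y)          ≡⟨ toℕ-fromℕ< (m%n<n (rank K y) p) ⟩
    rank K y % p           ≡⟨ m<n⇒m%n≡m (<-≤-trans (rank<∣K∣ y∈K) ∣K∣≤p) ⟩
    rank K y               ∎)
    where open ≡-Reasoning

arcOf : ∀ {p} → Vec (Subset p) p → Fin p → Fin p → Bool
arcOf M i j = lookup (lookup M j) i

isTournament? : ∀ {p} (T : Fin p → Fin p → Bool) → Dec (∀ i j → i ≢ j → T i j ≡ not (T j i))
isTournament? T = all? λ i → all? λ j → ¬? (i ≟ᶠ j) →-dec T i j ≟ᵇ not (T j i)

FewCommonInNeighbours : ∀ {p} → Vec (Subset p) p → ℕ → Set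
FewCommonInNeighbours M b = ∀ i j → i ≢ j → ∣ lookup M i ∩ lookup M j ∣ < b

fewCommonInNeighbours? : ∀ {p} (M : Vec (Subset p) p) b → Dec (FewCommonInNeighbours M b)
fewCommonInNeighbours? M b = all? λ i → all? λ j → ¬? (i ≟ᶠ j) →-dec ∣ lookup M i ∩ lookup M j ∣ <? b

domination-free-from-table : ∀ {p b} .{{_ : NonZero p}} (M : Vec (Subset p) p) →
  IsTournament (arcOf M) → FewCommonInNeighbours M b →
  ∀ {K : Subset n} → ∣ K ∣ ≤ p → DominationFree K 2 b
domination-free-from-table {p = p} {b} M tournament few {K} ∣K∣≤p =
  (λ x y → arcOf M (ι x) (ι y)) , (λ x∈K y∈K x≢y → tournament (x≢y ∘ ι-injective x∈K y∈K)) , free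
  where
  ι = embed K ∣K∣≤p
  ι-injective = embed-injective K ∣K∣≤p
  free : ¬ Domination (λ x y → arcOf M (ι x) (ι y)) 2 b K K
  free d =
    let y₁ , y₂ , y₁∈A , y₂∈A , y₁≢y₂ = two-elements ∣A∣≡a
        common = lookup M (ι y₁) ∩ lookup M (ι y₂)
        B↪common : ∀ {x} → x ∈ B → ι x ∈ common
        B↪common {x} x∈B = x∈p∩q⁺ ( lookup⇒[]= (ι x) (lookup M (ι y₁)) (B-beats-A x∈B y₁∈A)
                                  , lookup⇒[]= (ι x) (lookup M (ι y₂)) (B-beats-A x∈B y₂∈A))
        b≤∣common∣ = subst (_≤ ∣ common ∣) ∣B∣≡b
          (injection⇒∣p∣≤∣q∣ ι B↪common λ x∈B y∈B → ι-injective (B⊆Q x∈B) (B⊆Q y∈B))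
    in <⇒≱ (few (ι y₁) (ι y₂) (y₁≢y₂ ∘ ι-injective (A⊆P y₁∈A) (A⊆P y₂∈A))) b≤∣common∣
    where open Domination d

-- The Paley tournament: i beats j iff j − i is a nonzero square modulo p. For a prime
-- p ≡ 3 (mod 4) any two vertices have exactly (p − 3) / 4 common in-neighbours.
paley : (p : ℕ) .{{_ : NonZero p}} → Vec (Subset p) p
paley p = tabulate λ j → tabulate λ i → does (anyUpTo? (λ k → (0 <? k) ×-dec ((toℕ i + k * k) % p ≟ toℕ j)) p)

nCk≤n^k : ∀ n k → n C k ≤ n ^ k
nCk≤n^k n       zero    = ≤-refl
nCk≤n^k zero    (suc k) = z≤n
nCk≤n^k (suc n) (suc k) = begin
  suc n C suc k             ≡⟨ nCk+nC[k+1]≡[n+1]C[k+1] n k ⟨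
  n C k + n C suc k         ≤⟨ +-mono-≤ (nCk≤n^k n k) (nCk≤n^k n (suc k)) ⟩
  n ^ k + n * n ^ k         ≤⟨ +-mono-≤ (^-monoˡ-≤ k (n≤1+n n)) (*-monoʳ-≤ n (^-monoˡ-≤ k (n≤1+n n))) ⟩
  suc n ^ k + n * suc n ^ k ∎
  where open ≤-Reasoning

4L²≤2^L : ∀ {L} → 8 ≤ L → 4 * (L * L) ≤ 2 ^ L
4L²≤2^L {L} 8≤L = subst (λ L → 4 * (L * L) ≤ 2 ^ L) (m+[n∸m]≡n 8≤L) (from-8 (L ∸ 8))
  where
  from-8 : ∀ j → 4 * ((8 + j) * (8 + j)) ≤ 2 ^ (8 + j)
  from-8 zero    = ≤-refl
  from-8 (suc j) = begin
    4 * ((9 + j) * (9 + j))                                ≤⟨ m≤m+n _ (188 + 56 * j + 4 * (j * j)) ⟩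
    4 * ((9 + j) * (9 + j)) + (188 + 56 * j + 4 * (j * j)) ≡⟨ expand j ⟨
    2 * (4 * ((8 + j) * (8 + j)))                          ≤⟨ *-monoʳ-≤ 2 (from-8 j) ⟩
    2 ^ (9 + j)                                            ∎
    where
    open ≤-Reasoning
    expand : ∀ j → 2 * (4 * ((8 + j) * (8 + j))) ≡ 4 * ((9 + j) * (9 + j)) + (188 + 56 * j + 4 * (j * j))
    expand = solve-∀

power-of-two-between : ∀ w → 0 < w → ∃ λ L → w < 2 ^ L × 2 ^ L ≤ 2 * w
power-of-two-between 1             _ = 1 , s≤s (s≤s z≤n) , ≤-refl
power-of-two-between (suc (suc v)) _ with power-of-two-between (suc v) (s≤s z≤n)
... | L , v<2ᴸ , 2ᴸ≤2v with 2 + v <? 2 ^ L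
...   | yes 2+v<2ᴸ = L , 2+v<2ᴸ , ≤-trans 2ᴸ≤2v (*-monoʳ-≤ 2 (n≤1+n (suc v)))
...   | no  2+v≮2ᴸ = suc L , subst (2 + v <_) (cong (2 *_) (sym 2ᴸ≡2+v)) (m<m+n (2 + v) (s≤s z≤n))
                           , ≤-reflexive (cong (2 *_) 2ᴸ≡2+v)
  where
  2ᴸ≡2+v : 2 ^ L ≡ 2 + v
  2ᴸ≡2+v = ≤-antisym (≮⇒≥ 2+v≮2ᴸ) v<2ᴸ

Admissible : ℕ → ℕ → ℕ → Set
Admissible w a b = (w C a) * (w C b) < 2 ^ (a * b) × w ^ pred (a + b) ≤ 2 ^ (2 * w)

admissible? : ∀ w a b → Dec (Admissible w a b)
admissible? w a b = (w C a) * (w C b) <? 2 ^ (a * b) ×-dec w ^ pred (a + b) ≤? 2 ^ (2 * w)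

large-admissible : ∀ {w} → 128 ≤ w → ∃₂ (Admissible w)
large-admissible {w} 128≤w with power-of-two-between w (<-≤-trans (s≤s z≤n) 128≤w)
... | L , w<2ᴸ , 2ᴸ≤2w = 2 * L , 2 * L , binomials , exponent
  where
  8≤L : 8 ≤ L
  8≤L = ≮⇒≥ λ L<8 → <⇒≱ w<2ᴸ (≤-trans (^-monoʳ-≤ 2 (s≤s⁻¹ L<8)) 128≤w)
  instance
    c≢0 : NonZero (2 * L)
    c≢0 = >-nonZero (≤-trans (s≤s z≤n) (*-monoʳ-≤ 2 8≤L))
    w≢0 : NonZero w
    w≢0 = >-nonZero (<-≤-trans (s≤s z≤n) 128≤w)
  c = 2 * L
  binomials : (w C c) * (w C c) < 2 ^ (c * c)
  binomials = begin-strict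
    (w C c) * (w C c)           ≤⟨ *-mono-≤ (nCk≤n^k w c) (nCk≤n^k w c) ⟩
    w ^ c * w ^ c               <⟨ *-mono-< (^-monoˡ-< c w<2ᴸ) (^-monoˡ-< c w<2ᴸ) ⟩
    (2 ^ L) ^ c * (2 ^ L) ^ c   ≡⟨ cong₂ _*_ (^-*-assoc 2 L c) (^-*-assoc 2 L c) ⟩
    2 ^ (L * c) * 2 ^ (L * c)   ≡⟨ ^-distribˡ-+-* 2 (L * c) (L * c) ⟨
    2 ^ (L * c + L * c)         ≡⟨ cong (2 ^_) (twice L) ⟩
    2 ^ (c * c)                 ∎
    where
    open ≤-Reasoning
    twice : ∀ L → L * (2 * L) + L * (2 * L) ≡ 2 * L * (2 * L)
    twice = solve-∀
  exponent : w ^ pred (c + c) ≤ 2 ^ (2 * w)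
  exponent = begin
    w ^ pred (c + c)        ≤⟨ ^-monoʳ-≤ w (pred[n]≤n {c + c}) ⟩
    w ^ (c + c)             ≤⟨ ^-monoˡ-≤ (c + c) (<⇒≤ w<2ᴸ) ⟩
    (2 ^ L) ^ (c + c)       ≡⟨ ^-*-assoc 2 L (c + c) ⟩
    2 ^ (L * (c + c))       ≡⟨ cong (2 ^_) (four L) ⟩
    2 ^ (4 * (L * L))       ≤⟨ ^-monoʳ-≤ 2 (4L²≤2^L 8≤L) ⟩
    2 ^ (2 ^ L)             ≤⟨ ^-monoʳ-≤ 2 2ᴸ≤2w ⟩
    2 ^ (2 * w)             ∎
    where
    open ≤-Reasoning
    four : ∀ L → L * (2 * L + 2 * L) ≡ 4 * (L * L)
    four = solve-∀

check-range : ∀ {P : ℕ → Set} (P? : Decidable P) lo hi {_ : True (allUpTo? (λ w → lo ≤? w →-dec P? w) hi)} →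
              ∀ {w} → lo ≤ w → w < hi → P w
check-range P? lo hi {all-checked} lo≤w w<hi = toWitness all-checked w<hi lo≤w

-- Explicit pairs for 32 ≤ w < 128, where the estimate of large-admissible does not apply.
countingPair : ℕ → ℕ × ℕ
countingPair w =
  if      w ≤ᵇ 32 then 6 , 7
  else if w ≤ᵇ 41 then 7 , 7
  else if w ≤ᵇ 63 then 8 , 8
  else if w ≤ᵇ 97 then 9 , 9
  else                 10 , 10

medium-admissible : ∀ {w} → 32 ≤ w → w < 128 → ∃₂ (Admissible w)
medium-admissible {w} 32≤w w<128 = proj₁ (countingPair w) , proj₂ (countingPair w) ,
  check-range (λ w → admissible? w (proj₁ (countingPair w)) (proj₂ (countingPair w))) 32 128 32≤w w<128

record Certificate (K : Subset n) : Set where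
  field
    a b            : ℕ
    free           : DominationFree K a b
    small-exponent : ∣ K ∣ ^ pred (a + b) ≤ 2 ^ (2 * ∣ K ∣)

paley-certificate : ∀ {K : Subset n} p b .{{_ : NonZero p}} {_ : True (isTournament? (arcOf (paley p)))}
  {_ : True (fewCommonInNeighbours? (paley p) b)} → ∣ K ∣ ≤ p → ∣ K ∣ ^ suc b ≤ 2 ^ (2 * ∣ K ∣) → Certificate K
paley-certificate p b {tournament} {few} ∣K∣≤p bound = record
  { a              = 2
  ; b              = b
  ; free           = domination-free-from-table (paley p) (λ {i} {j} → toWitness tournament i j)
                                                (toWitness few) ∣K∣≤p
  ; small-exponent = bound
  }

counting-certificate : ∀ {K : Subset n} → ∃₂ (Admissible ∣ K ∣) → Certificate K
counting-certificate {K = K} (a , b , few , bound) =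
  record { a = a ; b = b ; free = domination-free-by-counting K few ; small-exponent = bound }

certificate : ∀ (K : Subset n) → 5 ≤ ∣ K ∣ → Certificate K
certificate K 5≤w with ∣ K ∣ <? 12 | ∣ K ∣ <? 20 | ∣ K ∣ <? 32 | ∣ K ∣ <? 128
... | yes w<12 | _        | _        | _         =
  paley-certificate 11 3 (s≤s⁻¹ w<12) (check-range (λ w → w ^ 4 ≤? 2 ^ (2 * w)) 5 12 5≤w w<12)
... | no  w≮12 | yes w<20 | _        | _         =
  paley-certificate 19 5 (s≤s⁻¹ w<20) (check-range (λ w → w ^ 6 ≤? 2 ^ (2 * w)) 12 20 (≮⇒≥ w≮12) w<20)
... | no  _    | no  w≮20 | yes w<32 | _         =
  paley-certificate 31 8 (s≤s⁻¹ w<32) (check-range (λ w → w ^ 9 ≤? 2 ^ (2 * w)) 20 32 (≮⇒≥ w≮20) w<32)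
... | no  _    | no  _    | no  w≮32 | yes w<128 = counting-certificate (medium-admissible (≮⇒≥ w≮32) w<128)
... | no  _    | no  _    | no  _    | no  w≮128 = counting-certificate (large-admissible (≮⇒≥ w≮128))

excess-bound : ∀ {G : Graph n} {m K} → IsMOF G m → IsClique G K → 2 ≤ ∣ K ∣ →
               ∃ λ c → ∣ K ∣ ∸ m ≤ c × ∣ K ∣ ^ c ≤ 2 ^ (2 * ∣ K ∣)
excess-bound {m = m} {K} mof clique 2≤w with ∣ K ∣ <? 5
... | yes w<5 = ∣ K ∣ , m∸n≤m ∣ K ∣ m , check-range (λ w → w ^ w ≤? 2 ^ (2 * w)) 2 5 2≤w w<5
... | no  w≮5 = pred (a + b) , <⇒≤pred (∣K∣∸m<a+b mof clique free) , small-exponent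
  where open Certificate (certificate K (≮⇒≥ w≮5))

corollary9 : ∀ (n : ℕ) (G : Graph n) (w m : ℕ) →
    IsCliqueNumber G w → 2 ≤ w → IsMOF G m →
    w ^ (w ∸ m) ≤ 2 ^ (2 * w)
corollary9 n G .(∣ K ∣) m ((K , clique , refl) , _) 2≤w mof =
  let c , excess≤c , ∣K∣^c≤4^∣K∣ = excess-bound mof clique 2≤w
  in  ≤-trans (^-monoʳ-≤ ∣ K ∣ {{>-nonZero (<-≤-trans (s≤s z≤n) 2≤w)}} excess≤c) ∣K∣^c≤4^∣K∣
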